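{- Let $F$ be a CNF formula, $(T,\delta)$ a decomposition tree of $I(F)$, and let $x,y,z$ be nodes of $T$ such that $x$ and $y$ are the children of $z$. Let $s$ be a shape for $z$. Then $$n_z(s)=\sum_{(s_x,s_y)\in\mathrm{Gen}_z(s)} n_x(s_x)\,n_y(s_y).$$
   Context: A clause is a finite set of literals (variables $x$ or negations $\bar x$) not containing both $x$ and $\bar x$; a CNF formula $F$ is a finite set of clauses; $\mathrm{var}(C)$, $\mathrm{var}(F)$ denote occurring variables. The incidence graph $I(F)$ has vertex set $\mathrm{var}(F)\cup F$ and edges $Cx$ for $x\in\mathrm{var}(C)$. A decomposition tree of a graph is a pair $(T,\delta)$ with $T$ a rooted binary tree and $\delta$ a bijection from the leaves of $T$ to the vertex set. For a set of variables $X$, $2^X$ is the set of maps $\sigma:X\to\{0,1\}$ ($\sigma(\bar x)=1-\sigma(x)$); $\sigma$ satisfies clause $C$ if $\sigma(\ell)=1$ for some $\ell\in C$ with variable in $X$. For a set of clauses $G$, $G(\sigma)$ is the set of clauses of $G$ satisfied by $\sigma$. For a node $z$ of $T$ let $T_z$ be the subtree rooted at $z$ with leaf set $L(T_z)$; $\mathrm{var}_z=\mathrm{var}(F)\cap\delta(L(T_z))$, $F_z=F\cap\delta(L(T_z))$, $\overline{F_z}=F\setminus F_z$. A shape for $z$ is a pair $(\mathit{out},\mathit{in})$ with $\mathit{out}\subseteq\overline{F_z}$, $\mathit{in}\subseteq F_z$; $\mathcal{S}_z$ denotes the set of shapes for $z$. An assignment $\tau\in2^{\mathrm{var}_z}$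 is of shape $(\mathit{out},\mathit{in})$ if (i) $\overline{F_z}(\tau)=\mathit{out}$ and (ii) every clause $C\in F_z$ is satisfied by $\tau$ or belongs to $\mathit{in}$. $N_z(s)$ is the set of assignments in $2^{\mathrm{var}_z}$ of shape $s$ and $n_z(s)=|N_z(s)|$. If $x,y$ are the children of $z$, shapes $(\mathit{out}_x,\mathit{in}_x)\in\mathcal{S}_x$ and $(\mathit{out}_y,\mathit{in}_y)\in\mathcal{S}_y$ generate $(\mathit{out}_z,\mathit{in}_z)\in\mathcal{S}_z$ if (1) $\mathit{out}_z=(\mathit{out}_x\cup\mathit{out}_y)\cap\overline{F_z}$, (2) $\mathit{in}_x=(\mathit{in}_z\cup\mathit{out}_y)\cap F_x$, and (3) $\mathit{in}_y=(\mathit{in}_z\cup\mathit{out}_x)\cap F_y$. $\mathrm{Gen}_z(s)$ is the set of pairs in $\mathcal{S}_x\times\mathcal{S}_y$ that generate $s$. -}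

module Defs where

open import Data.Nat using (ℕ; zero; suc; _*_)
open import Data.Bool using (Bool; true; false)
open import Data.Fin using (Fin)
open import Data.Fin.Properties using (all?)
open import Data.Fin.Subset using (Subset; _∈_; _∉_)
open import Data.Fin.Subset.Properties using (_∈?_)
open import Data.Vec using ([]; _∷_)
open import Data.List using (List; []; _∷_; concatMap; filter; length; map; cartesianProduct)
open import Data.Nat.ListAction using (sum)
open import Data.List.Relation.Unary.Any using (Any; any?)
open import Data.List.Relation.Unary.Unique.Propositional using (Unique)
open import Data.Product using (_×_; _,_; ∃; ∃₂; proj₁; proj₂)
open import Data.Product.Properties as ×P using ()
open import Data.Sum using (_⊎_; inj₁; inj₂)
open import Data.Sum.Properties as ⊎P using ()
open import Data.Bool.Properties as BoolP using ()
open import Data.Nat.Properties as ℕP using ()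
open import Data.Fin.Properties as FinP using ()
open import Relation.Binary.PropositionalEquality using (_≡_; _≢_)
open import Relation.Binary using (DecidableEquality)
open import Relation.Nullary using (¬_; Dec)
open import Relation.Nullary.Decidable using (_×-dec_; _⊎-dec_; _→-dec_; ¬?)
import Data.List.Membership.Propositional as MemP
import Data.List.Membership.DecPropositional as DecMem

Var : Set
Var = ℕ

-- A literal is a pair (x , b): (x , true) is the positive literal x and
-- (x , false) is the negative literal x̄.
Literal : Set
Literal = Var × Bool

_≟L_ : DecidableEquality Literal
_≟L_ = ×P.≡-dec ℕP._≟_ BoolP._≟_

open MemP using () renaming (_∈_ to _∈ₗ_)

-- A clause is a finite set of literals, represented by a duplicate-free list
-- (see IsClause).
Clause : Set
Clause = List Literal

_∈var_ : Var → Clause → Set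
x ∈var C = ∃ λ b → (x , b) ∈ₗ C

IsClause : Clause → Set
IsClause C = Unique C × (∀ x → ¬ ((x , true) ∈ₗ C × (x , false) ∈ₗ C))

SameSet : Clause → Clause → Set
SameSet C D = ∀ ℓ → (ℓ ∈ₗ C → ℓ ∈ₗ D) × (ℓ ∈ₗ D → ℓ ∈ₗ C)

-- A CNF formula with m clauses is given by an indexing F : Fin m → Clause
-- of its clauses; being a *set* of clauses, distinct indices carry distinct
-- clauses.
IsCNF : ∀ {m} → (Fin m → Clause) → Set
IsCNF {m} F = (∀ i → IsClause (F i)) × (∀ i j → SameSet (F i) (F j) → i ≡ j)

_∈varF_ : ∀ {m} → Var → (Fin m → Clause) → Set
x ∈varF F = ∃ λ i → x ∈var F i

-- Candidate vertices of I(F): a variable (inj₁) or a clause index (inj₂).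
Vertex : ℕ → Set
Vertex m = Var ⊎ Fin m

_≟V_ : ∀ {m} → DecidableEquality (Vertex m)
_≟V_ = ⊎P.≡-dec ℕP._≟_ FinP._≟_

IsVertex : ∀ {m} → (Fin m → Clause) → Vertex m → Set
IsVertex F (inj₁ x) = x ∈varF F
IsVertex F (inj₂ i) = Data.Unit.⊤
  where import Data.Unit

-- Rooted binary trees whose leaves carry labels (the label of a leaf is its
-- image under δ).  Inner nodes have one or two children.
data Tree (V : Set) : Set where
  leaf  : V → Tree V
  node₁ : Tree V → Tree V
  node  : Tree V → Tree V → Tree V

labels : ∀ {V} → Tree V → List V
labels (leaf v) = v ∷ []
labels (node₁ t) = labels t
labels (node l r) = labels l Data.List.++ labels r

-- s ≼ t : s is (the subtree T_z rooted at) a node z of t.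
data _≼_ {V : Set} : Tree V → Tree V → Set where
  here  : ∀ {t} → t ≼ t
  down  : ∀ {s t} → s ≼ t → s ≼ node₁ t
  left  : ∀ {s l r} → s ≼ l → s ≼ node l r
  right : ∀ {s l r} → s ≼ r → s ≼ node l r

-- (T, δ) is a decomposition tree of I(F): δ is a bijection from the leaves
-- of T onto var(F) ∪ F (injective = labels distinct; onto vertex set).
IsDecompTree : ∀ {m} → (Fin m → Clause) → Tree (Vertex m) → Set
IsDecompTree F T =
  Unique (labels T) × (∀ v → (v ∈ₗ labels T → IsVertex F v) × (IsVertex F v → v ∈ₗ labels T))

varsOf : ∀ {m} → Tree (Vertex m) → List Var
varsOf {m} t = concatMap pick (labels t)
  where
  pick : Vertex m → List Var
  pick (inj₁ x) = x ∷ []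
  pick (inj₂ _) = []

InF : ∀ {m} → Tree (Vertex m) → Fin m → Set
InF t i = inj₂ i ∈ₗ labels t

InF? : ∀ {m} (t : Tree (Vertex m)) (i : Fin m) → Dec (InF t i)
InF? {m} t i = DecMem._∈?_ (_≟V_ {m}) (inj₂ i) (labels t)

-- An assignment τ ∈ 2^X (X given as a duplicate-free list) is represented
-- by its graph, the list of literals made true: (x , τ(x)) for x ∈ X.
Assignment : Set
Assignment = List Literal

assignments : List Var → List Assignment
assignments [] = [] ∷ []
assignments (x ∷ xs) =
  concatMap (λ τ → ((x , true) ∷ τ) ∷ ((x , false) ∷ τ) ∷ []) (assignments xs)

Sat : Assignment → Clause → Set
Sat τ C = Any (λ ℓ → ℓ ∈ₗ τ) C

Sat? : ∀ τ C → Dec (Sat τ C)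
Sat? τ C = any? (λ ℓ → DecMem._∈?_ _≟L_ ℓ τ) C

Shape : ℕ → Set
Shape m = Subset m × Subset m     -- (out , in)

IsShape : ∀ {m} → Tree (Vertex m) → Shape m → Set
IsShape t (out , inn) = (∀ i → i ∈ out → ¬ InF t i) × (∀ i → i ∈ inn → InF t i)

IsShape? : ∀ {m} t (s : Shape m) → Dec (IsShape t s)
IsShape? t (out , inn) =
  all? (λ i → (i ∈? out) →-dec ¬? (InF? t i)) ×-dec all? (λ i → (i ∈? inn) →-dec InF? t i)

_⇔-dec_ : ∀ {A B : Set} → Dec A → Dec B → Dec ((A → B) × (B → A))
a ⇔-dec b = (a →-dec b) ×-dec (b →-dec a)

OfShape : ∀ {m} → (Fin m → Clause) → Tree (Vertex m) → Shape m → Assignment → Set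
OfShape F t (out , inn) τ =
  (∀ i → (i ∈ out → (¬ InF t i × Sat τ (F i))) × ((¬ InF t i × Sat τ (F i)) → i ∈ out))
  × (∀ i → InF t i → Sat τ (F i) ⊎ i ∈ inn)

OfShape? : ∀ {m} F t (s : Shape m) τ → Dec (OfShape F t s τ)
OfShape? F t (out , inn) τ =
  all? (λ i → (i ∈? out) ⇔-dec (¬? (InF? t i) ×-dec Sat? τ (F i)))
  ×-dec all? (λ i → InF? t i →-dec (Sat? τ (F i) ⊎-dec (i ∈? inn)))

count : ∀ {m} → (Fin m → Clause) → Tree (Vertex m) → Shape m → ℕ
count F t s = length (filter (OfShape? F t s) (assignments (varsOf t)))

allSubsets : ∀ n → List (Subset n)
allSubsets zero = [] ∷ []
allSubsets (suc n) = concatMap (λ p → (true ∷ p) ∷ (false ∷ p) ∷ []) (allSubsets n)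

allShapes : ∀ m → List (Shape m)
allShapes m = cartesianProduct (allSubsets m) (allSubsets m)

Generates : ∀ {m} → Tree (Vertex m) → Tree (Vertex m) → Shape m → Shape m → Shape m → Set
Generates tx ty (outx , inx) (outy , iny) (outz , inz) =
  let tz = node tx ty in
    (∀ i → (i ∈ outz → ((i ∈ outx ⊎ i ∈ outy) × ¬ InF tz i))
         × (((i ∈ outx ⊎ i ∈ outy) × ¬ InF tz i) → i ∈ outz))
  × (∀ i → (i ∈ inx → ((i ∈ inz ⊎ i ∈ outy) × InF tx i))
         × (((i ∈ inz ⊎ i ∈ outy) × InF tx i) → i ∈ inx))
  × (∀ i → (i ∈ iny → ((i ∈ inz ⊎ i ∈ outx) × InF ty i))
         × (((i ∈ inz ⊎ i ∈ outx) × InF ty i) → i ∈ iny))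

Generates? : ∀ {m} tx ty (sx sy sz : Shape m) → Dec (Generates tx ty sx sy sz)
Generates? tx ty (outx , inx) (outy , iny) (outz , inz) =
  all? (λ i → (i ∈? outz) ⇔-dec (((i ∈? outx) ⊎-dec (i ∈? outy)) ×-dec ¬? (InF? (node tx ty) i)))
  ×-dec all? (λ i → (i ∈? inx) ⇔-dec (((i ∈? inz) ⊎-dec (i ∈? outy)) ×-dec InF? tx i))
  ×-dec all? (λ i → (i ∈? iny) ⇔-dec (((i ∈? inz) ⊎-dec (i ∈? outx)) ×-dec InF? ty i))

InGen : ∀ {m} → Tree (Vertex m) → Tree (Vertex m) → Shape m → Shape m × Shape m → Set
InGen tx ty s (sx , sy) = (IsShape tx sx × IsShape ty sy) × Generates tx ty sx sy s

InGen? : ∀ {m} tx ty (s : Shape m) p → Dec (InGen tx ty s p)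
InGen? tx ty s (sx , sy) = (IsShape? tx sx ×-dec IsShape? ty sy) ×-dec Generates? tx ty sx sy s

-- Gen_z(s), enumerated without repetition
Gen : ∀ {m} → Tree (Vertex m) → Tree (Vertex m) → Shape m → List (Shape m × Shape m)
Gen {m} tx ty s = filter (InGen? tx ty s) (cartesianProduct (allShapes m) (allShapes m))

genSum : ∀ {m} → (Fin m → Clause) → Tree (Vertex m) → Tree (Vertex m) → Shape m → ℕ
genSum F tx ty s = sum (map (λ p → count F tx (proj₁ p) * count F ty (proj₂ p)) (Gen tx ty s))

-- Write var_z = var_x ++ var_y, so every τ ∈ 2^{var_z} is a unique concatenation
-- τ_x ++ τ_y.  Since F_x and F_y are disjoint, τ has shape s for z exactly when
-- τ_x and τ_y have the shapes s_x = (F̄_x(τ_x) , (in_z ∪ out_y) ∩ F_x) and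
-- s_y = (F̄_y(τ_y) , (in_z ∪ out_x) ∩ F_y), and these form the only pair of
-- Gen_z(s) fitting τ_x and τ_y.  Summing indicators over τ_x, τ_y and the pairs
-- of shapes, then exchanging the order of summation, gives the formula.
module Submission where

open import Defs
open import Data.Nat using (ℕ; suc; _+_; _*_)
open import Data.Nat.Properties using (+-identityʳ; +-assoc; *-zeroʳ; *-distribˡ-+; *-distribʳ-+; +-commutativeSemigroup)
open import Algebra.Properties.CommutativeSemigroup +-commutativeSemigroup using () renaming (interchange to +-interchange)
open import Data.Bool using (true; false)
open import Data.Fin using (Fin)
open import Data.Fin.Subset using (Subset; _∈_)
open import Data.Fin.Subset.Properties using (_∈?_; ⊆-antisym)
open import Data.Vec using ([]; _∷_; tabulate; tail)
open import Data.Vec.Properties using (lookup∘tabulate; []=⇒lookup; lookup⇒[]=)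
open import Data.List using (List; []; _∷_; _++_; concatMap; filter; length; map; cartesianProduct)
open import Data.Nat.ListAction using (sum)
import Data.List.Relation.Unary.Any as Any
open import Data.List.Relation.Unary.Any.Properties using (Any-⊎⁻)
open import Data.List.Relation.Unary.All using () renaming (lookup to All-lookup)
open import Data.List.Relation.Unary.All.Properties using (++⁻ˡ)
open import Data.List.Relation.Unary.AllPairs using ([]; _∷_)
open import Data.List.Relation.Unary.Unique.Propositional using (Unique)
open import Data.List.Relation.Binary.Disjoint.Propositional using (Disjoint)
open import Data.List.Membership.Propositional.Properties using (∈-++⁻; ∈-++⁺ˡ; ∈-++⁺ʳ)
open import Data.List.Properties using (concatMap-++)
open import Data.Product using (_×_; _,_; proj₁; proj₂)
open import Data.Sum using (_⊎_; inj₁; inj₂)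
open import Function using (_∘_)
open import Relation.Nullary using (¬_; Dec; yes; no; does)
open import Relation.Nullary.Decidable using (_×-dec_; _⊎-dec_; ¬?)
open import Relation.Unary using (Decidable)
open import Relation.Binary.PropositionalEquality using (_≡_; _≢_; refl; sym; trans; cong; cong₂; module ≡-Reasoning)
open ≡-Reasoning

private
  variable
    A B : Set

∑ : List A → (A → ℕ) → ℕ
∑ L f = sum (map f L)

∑-cong : ∀ (L : List A) {f g : A → ℕ} → (∀ a → f a ≡ g a) → ∑ L f ≡ ∑ L g
∑-cong []      f≡g = refl
∑-cong (a ∷ L) f≡g = cong₂ _+_ (f≡g a) (∑-cong L f≡g)

∑-zero : ∀ (L : List A) {f : A → ℕ} → (∀ a → f a ≡ 0) → ∑ L f ≡ 0
∑-zero []      f≡0 = refl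
∑-zero (a ∷ L) f≡0 = cong₂ _+_ (f≡0 a) (∑-zero L f≡0)

∑-++ : ∀ (xs ys : List A) (f : A → ℕ) → ∑ (xs ++ ys) f ≡ ∑ xs f + ∑ ys f
∑-++ []       ys f = refl
∑-++ (x ∷ xs) ys f = trans (cong (f x +_) (∑-++ xs ys f)) (sym (+-assoc (f x) _ _))

∑-map : ∀ (g : A → B) (L : List A) (f : B → ℕ) → ∑ (map g L) f ≡ ∑ L (f ∘ g)
∑-map g []      f = refl
∑-map g (a ∷ L) f = cong (f (g a) +_) (∑-map g L f)

∑-concatMap-pair : ∀ (g k : A → B) (L : List A) (f : B → ℕ) →
  ∑ (concatMap (λ a → g a ∷ k a ∷ []) L) f ≡ ∑ L (λ a → f (g a) + f (k a))
∑-concatMap-pair g k []      f = refl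
∑-concatMap-pair g k (a ∷ L) f =
  trans (cong (λ n → f (g a) + (f (k a) + n)) (∑-concatMap-pair g k L f)) (sym (+-assoc (f (g a)) _ _))

∑-+ : ∀ (L : List A) (f g : A → ℕ) → ∑ L (λ a → f a + g a) ≡ ∑ L f + ∑ L g
∑-+ []      f g = refl
∑-+ (a ∷ L) f g =
  trans (cong (f a + g a +_) (∑-+ L f g)) (+-interchange (f a) (g a) (∑ L f) (∑ L g))

∑-*ˡ : ∀ (k : ℕ) (L : List A) (f : A → ℕ) → k * ∑ L f ≡ ∑ L (λ a → k * f a)
∑-*ˡ k []      f = *-zeroʳ k
∑-*ˡ k (a ∷ L) f = trans (*-distribˡ-+ k (f a) _) (cong (k * f a +_) (∑-*ˡ k L f))

∑-*ʳ : ∀ (k : ℕ) (L : List A) (f : A → ℕ) → ∑ L f * k ≡ ∑ L (λ a → f a * k)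
∑-*ʳ k []      f = refl
∑-*ʳ k (a ∷ L) f = trans (*-distribʳ-+ k (f a) _) (cong (f a * k +_) (∑-*ʳ k L f))

∑-* : ∀ (LA : List A) (LB : List B) (f : A → ℕ) (g : B → ℕ) →
  ∑ LA f * ∑ LB g ≡ ∑ LA (λ a → ∑ LB (λ b → f a * g b))
∑-* LA LB f g =
  trans (∑-*ʳ (∑ LB g) LA f) (∑-cong LA (λ a → ∑-*ˡ (f a) LB g))

∑-comm : ∀ (LA : List A) (LB : List B) (f : A → B → ℕ) →
  ∑ LA (λ a → ∑ LB (f a)) ≡ ∑ LB (λ b → ∑ LA (λ a → f a b))
∑-comm []       LB f = sym (∑-zero LB (λ _ → refl))
∑-comm (a ∷ LA) LB f =
  trans (cong (∑ LB (f a) +_) (∑-comm LA LB f)) (sym (∑-+ LB (f a) _))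

∑-cartesianProduct : ∀ (LA : List A) (LB : List B) (f : A × B → ℕ) →
  ∑ (cartesianProduct LA LB) f ≡ ∑ LA (λ a → ∑ LB (λ b → f (a , b)))
∑-cartesianProduct []       LB f = refl
∑-cartesianProduct (a ∷ LA) LB f =
  trans (∑-++ (map (a ,_) LB) _ f)
        (cong₂ _+_ (∑-map (a ,_) LB f) (∑-cartesianProduct LA LB f))

𝟙 : {P : Set} → Dec P → ℕ
𝟙 (yes _) = 1
𝟙 (no _)  = 0

𝟙-yes : {P : Set} (P? : Dec P) → P → 𝟙 P? ≡ 1
𝟙-yes (yes _) _ = refl
𝟙-yes (no ¬p) p with () ← ¬p p

𝟙-no : {P : Set} (P? : Dec P) → ¬ P → 𝟙 P? ≡ 0
𝟙-no (yes p) ¬p with () ← ¬p p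
𝟙-no (no _)  _  = refl

𝟙-× : {P Q : Set} (P? : Dec P) (Q? : Dec Q) → 𝟙 (P? ×-dec Q?) ≡ 𝟙 P? * 𝟙 Q?
𝟙-× (yes _) (yes _) = refl
𝟙-× (yes _) (no _)  = refl
𝟙-× (no _)  _       = refl

length-filter-∑ : ∀ {P : A → Set} (P? : Decidable P) (L : List A) →
  length (filter P? L) ≡ ∑ L (𝟙 ∘ P?)
length-filter-∑ P? []      = refl
length-filter-∑ P? (a ∷ L) with P? a
... | yes _ = cong suc (length-filter-∑ P? L)
... | no _  = length-filter-∑ P? L

∑-filter : ∀ {P : A → Set} (P? : Decidable P) (L : List A) (f : A → ℕ) →
  ∑ (filter P? L) f ≡ ∑ L (λ a → 𝟙 (P? a) * f a)
∑-filter P? []      f = refl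
∑-filter P? (a ∷ L) f with P? a
... | yes _ = cong₂ _+_ (sym (+-identityʳ (f a))) (∑-filter P? L f)
... | no _  = ∑-filter P? L f

∑-∑-𝟙-× : ∀ {G : Set} {P : A → Set} {Q : B → Set} (G? : Dec G) (P? : Decidable P) (Q? : Decidable Q)
  (LA : List A) (LB : List B) →
  ∑ LA (λ a → ∑ LB (λ b → 𝟙 (G? ×-dec (P? a ×-dec Q? b))))
    ≡ 𝟙 G? * (length (filter P? LA) * length (filter Q? LB))
∑-∑-𝟙-× G? P? Q? LA LB = begin
  ∑ LA (λ a → ∑ LB (λ b → 𝟙 (G? ×-dec (P? a ×-dec Q? b))))
    ≡⟨ ∑-cong LA (λ a → ∑-cong LB (λ b → trans (𝟙-× G? _) (cong (𝟙 G? *_) (𝟙-× (P? a) (Q? b))))) ⟩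
  ∑ LA (λ a → ∑ LB (λ b → 𝟙 G? * (𝟙 (P? a) * 𝟙 (Q? b))))
    ≡⟨ sym (trans (∑-*ˡ (𝟙 G?) LA _) (∑-cong LA (λ a → ∑-*ˡ (𝟙 G?) LB _))) ⟩
  𝟙 G? * ∑ LA (λ a → ∑ LB (λ b → 𝟙 (P? a) * 𝟙 (Q? b)))
    ≡⟨ cong (𝟙 G? *_) (sym (∑-* LA LB _ _)) ⟩
  𝟙 G? * (∑ LA (𝟙 ∘ P?) * ∑ LB (𝟙 ∘ Q?))
    ≡⟨ cong (𝟙 G? *_) (sym (cong₂ _*_ (length-filter-∑ P? LA) (length-filter-∑ Q? LB))) ⟩
  𝟙 G? * (length (filter P? LA) * length (filter Q? LB)) ∎

-- A list containing p exactly once, characterised by its effect on sums.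
OccursOnce : List A → A → Set
OccursOnce {A} L p = ∀ (h : A → ℕ) → (∀ q → q ≢ p → h q ≡ 0) → ∑ L h ≡ h p

OccursOnce-cartesianProduct : ∀ {LA : List A} {LB : List B} {a b} →
  OccursOnce LA a → OccursOnce LB b → OccursOnce (cartesianProduct LA LB) (a , b)
OccursOnce-cartesianProduct {LA = LA} {LB} {a} {b} once-a once-b h h≡0 = begin
  ∑ (cartesianProduct LA LB) h              ≡⟨ ∑-cartesianProduct LA LB h ⟩
  ∑ LA (λ a′ → ∑ LB (λ b′ → h (a′ , b′)))   ≡⟨ once-a _ (λ a′ a′≢a → ∑-zero LB (λ b′ → h≡0 _ (a′≢a ∘ cong proj₁))) ⟩
  ∑ LB (λ b′ → h (a , b′))                  ≡⟨ once-b _ (λ b′ b′≢b → h≡0 _ (b′≢b ∘ cong proj₂)) ⟩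
  h (a , b)                                 ∎

OccursOnce-allSubsets : ∀ n (p : Subset n) → OccursOnce (allSubsets n) p
OccursOnce-allSubsets _ [] h _ = +-identityʳ (h [])
OccursOnce-allSubsets (suc n) (b ∷ p) h h≡0 = begin
  ∑ (allSubsets (suc n)) h                ≡⟨ ∑-concatMap-pair (true ∷_) (false ∷_) (allSubsets n) h ⟩
  ∑ (allSubsets n) (λ q → h (true ∷ q) + h (false ∷ q))
    ≡⟨ OccursOnce-allSubsets n p _ (λ q q≢p → cong₂ _+_ (h≡0 _ (q≢p ∘ cong tail)) (h≡0 _ (q≢p ∘ cong tail))) ⟩
  h (true ∷ p) + h (false ∷ p)            ≡⟨ pick b h≡0 ⟩
  h (b ∷ p)                               ∎
  where
  pick : ∀ b → (∀ q → q ≢ b ∷ p → h q ≡ 0) → h (true ∷ p) + h (false ∷ p) ≡ h (b ∷ p)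
  pick true  h≡0 = trans (cong (h (true ∷ p) +_) (h≡0 _ (λ ()))) (+-identityʳ _)
  pick false h≡0 = cong (_+ h (false ∷ p)) (h≡0 _ (λ ()))

OccursOnce-allShapes : ∀ {m} (s : Shape m) → OccursOnce (allShapes m) s
OccursOnce-allShapes {m} (out , inn) =
  OccursOnce-cartesianProduct {LA = allSubsets m} {LB = allSubsets m}
    (OccursOnce-allSubsets m out) (OccursOnce-allSubsets m inn)

OccursOnce-shapePairs : ∀ {m} (q : Shape m × Shape m) →
  OccursOnce (cartesianProduct (allShapes m) (allShapes m)) q
OccursOnce-shapePairs {m} (sx , sy) =
  OccursOnce-cartesianProduct {LA = allShapes m} {LB = allShapes m}
    (OccursOnce-allShapes sx) (OccursOnce-allShapes sy)

∑-𝟙-unique : ∀ {P : A → Set} {Q : Set} (P? : Decidable P) (Q? : Dec Q) {L : List A} {p : A} →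
  OccursOnce L p → (Q → P p) → (∀ {q} → P q → q ≡ p) → (∀ {q} → P q → Q) →
  ∑ L (𝟙 ∘ P?) ≡ 𝟙 Q?
∑-𝟙-unique P? (no ¬Q) {L} _ _ _ P⇒Q = ∑-zero L (λ q → 𝟙-no (P? q) (¬Q ∘ P⇒Q))
∑-𝟙-unique P? (yes Q) once Q⇒Pp P⇒≡p _ =
  trans (once (𝟙 ∘ P?) (λ q q≢p → 𝟙-no (P? q) (q≢p ∘ P⇒≡p))) (𝟙-yes (P? _) (Q⇒Pp Q))

∑-assignments-++ : ∀ (xs ys : List Var) (f : Assignment → ℕ) →
  ∑ (assignments (xs ++ ys)) f ≡ ∑ (assignments xs) (λ a → ∑ (assignments ys) (λ b → f (a ++ b)))
∑-assignments-++ []       ys f = sym (+-identityʳ _)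
∑-assignments-++ (x ∷ xs) ys f = begin
  ∑ (assignments (x ∷ xs ++ ys)) f
    ≡⟨ ∑-concatMap-pair ((x , true) ∷_) ((x , false) ∷_) (assignments (xs ++ ys)) f ⟩
  ∑ (assignments (xs ++ ys)) (λ τ → f ((x , true) ∷ τ) + f ((x , false) ∷ τ))
    ≡⟨ ∑-assignments-++ xs ys _ ⟩
  ∑ (assignments xs) (λ a → ∑ (assignments ys) (λ b → f ((x , true) ∷ a ++ b) + f ((x , false) ∷ a ++ b)))
    ≡⟨ ∑-cong (assignments xs) (λ a → ∑-+ (assignments ys) _ _) ⟩
  ∑ (assignments xs) (λ a → ∑ (assignments ys) (λ b → f ((x , true) ∷ a ++ b))
                          + ∑ (assignments ys) (λ b → f ((x , false) ∷ a ++ b)))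
    ≡⟨ sym (∑-concatMap-pair ((x , true) ∷_) ((x , false) ∷_) (assignments xs) _) ⟩
  ∑ (assignments (x ∷ xs)) (λ a → ∑ (assignments ys) (λ b → f (a ++ b)))
    ∎

varsOf-node : ∀ {m} (tx ty : Tree (Vertex m)) → varsOf (node tx ty) ≡ varsOf tx ++ varsOf ty
varsOf-node tx ty = concatMap-++ _ (labels tx) (labels ty)

count-node : ∀ {m} (F : Fin m → Clause) (tx ty : Tree (Vertex m)) (s : Shape m) →
  count F (node tx ty) s
    ≡ ∑ (assignments (varsOf tx)) (λ a → ∑ (assignments (varsOf ty)) (λ b → 𝟙 (OfShape? F (node tx ty) s (a ++ b))))
count-node {m} F tx ty s = begin
  length (filter (OfShape? F tz s) (assignments (varsOf tz)))
    ≡⟨ length-filter-∑ {P = OfShape F tz s} (OfShape? F tz s) (assignments (varsOf tz)) ⟩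
  ∑ (assignments (varsOf tz)) (𝟙 ∘ OfShape? F tz s)
    ≡⟨ cong (λ vs → ∑ (assignments vs) (𝟙 ∘ OfShape? F tz s)) (varsOf-node tx ty) ⟩
  ∑ (assignments (varsOf tx ++ varsOf ty)) (𝟙 ∘ OfShape? F tz s)
    ≡⟨ ∑-assignments-++ (varsOf tx) (varsOf ty) _ ⟩
  ∑ (assignments (varsOf tx)) (λ a → ∑ (assignments (varsOf ty)) (λ b → 𝟙 (OfShape? F tz s (a ++ b))))
    ∎
  where
  tz : Tree (Vertex m)
  tz = node tx ty

Sat-++⁻ : ∀ (τx τy : Assignment) {C : Clause} → Sat (τx ++ τy) C → Sat τx C ⊎ Sat τy C
Sat-++⁻ τx τy = Any-⊎⁻ ∘ Any.map (∈-++⁻ τx)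

Sat-++⁺ˡ : ∀ {τx : Assignment} (τy : Assignment) {C : Clause} → Sat τx C → Sat (τx ++ τy) C
Sat-++⁺ˡ τy = Any.map ∈-++⁺ˡ

Sat-++⁺ʳ : ∀ (τx : Assignment) {τy : Assignment} {C : Clause} → Sat τy C → Sat (τx ++ τy) C
Sat-++⁺ʳ τx = Any.map (∈-++⁺ʳ τx)

Unique-++⁻ : ∀ (xs : List A) {ys : List A} → Unique (xs ++ ys) →
  Unique xs × Unique ys × Disjoint xs ys
Unique-++⁻ []       ys! = [] , ys! , λ ()
Unique-++⁻ (x ∷ xs) {ys} (x∉ ∷ xs++ys!) with Unique-++⁻ xs xs++ys!
... | xs! , ys! , xs#ys = ++⁻ˡ xs x∉ ∷ xs! , ys! , disjoint
  where
  disjoint : Disjoint (x ∷ xs) ys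
  disjoint (Any.here refl , v∈ys) = All-lookup x∉ (∈-++⁺ʳ xs v∈ys) refl
  disjoint (Any.there v∈xs , v∈ys) = xs#ys (v∈xs , v∈ys)

Unique-labels-≼ : ∀ {V : Set} {s t : Tree V} → s ≼ t → Unique (labels t) → Unique (labels s)
Unique-labels-≼ here                t! = t!
Unique-labels-≼ (down s≼t)          t! = Unique-labels-≼ s≼t t!
Unique-labels-≼ (left {l = l} s≼l)  t! = Unique-labels-≼ s≼l (proj₁ (Unique-++⁻ (labels l) t!))
Unique-labels-≼ (right {l = l} s≼r) t! = Unique-labels-≼ s≼r (proj₁ (proj₂ (Unique-++⁻ (labels l) t!)))

Characterises : ∀ {m} → Subset m → (Fin m → Set) → Set
Characterises p P = ∀ i → (i ∈ p → P i) × (P i → i ∈ p)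

fromDec : ∀ {m} {P : Fin m → Set} → Decidable P → Subset m
fromDec P? = tabulate (does ∘ P?)

∈-fromDec : ∀ {m} {P : Fin m → Set} (P? : Decidable P) → Characterises (fromDec P?) P
∈-fromDec {P = P} P? i = member⇒P , P⇒member
  where
  member⇒P : i ∈ fromDec P? → P i
  member⇒P i∈ with P? i | trans (sym (lookup∘tabulate (does ∘ P?) i)) ([]=⇒lookup i∈)
  ... | yes p | _ = p
  P⇒member : P i → i ∈ fromDec P?
  P⇒member p = lookup⇒[]= i _ (trans (lookup∘tabulate (does ∘ P?) i) (does-yes (P? i)))
    where
    does-yes : (d : Dec (P i)) → does d ≡ true
    does-yes (yes _) = refl
    does-yes (no ¬p) with () ← ¬p p

fromDec-unique : ∀ {m} {P : Fin m → Set} (P? : Decidable P) {p : Subset m} →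
  Characterises p P → p ≡ fromDec P?
fromDec-unique P? p⇔P =
  ⊆-antisym (proj₂ (∈-fromDec P? _) ∘ proj₁ (p⇔P _)) (proj₂ (p⇔P _) ∘ proj₁ (∈-fromDec P? _))

module Split {m} (F : Fin m → Clause) (tx ty : Tree (Vertex m))
  (Fx#Fy : Disjoint (labels tx) (labels ty)) (outz inz : Subset m) (τx τy : Assignment) where

  private
    tz : Tree (Vertex m)
    tz = node tx ty

    τ : Assignment
    τ = τx ++ τy

    s : Shape m
    s = outz , inz

    InF-node⁻ : ∀ {i} → InF tz i → InF tx i ⊎ InF ty i
    InF-node⁻ = ∈-++⁻ (labels tx)

    InF-nodeˡ : ∀ {i} → InF tx i → InF tz i
    InF-nodeˡ = ∈-++⁺ˡ

    InF-nodeʳ : ∀ {i} → InF ty i → InF tz i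
    InF-nodeʳ = ∈-++⁺ʳ (labels tx)

  SatOutside : Tree (Vertex m) → Assignment → Fin m → Set
  SatOutside t σ i = ¬ InF t i × Sat σ (F i)

  SatOutside? : ∀ t σ → Decidable (SatOutside t σ)
  SatOutside? t σ i = ¬? (InF? t i) ×-dec Sat? σ (F i)

  Deferred : Tree (Vertex m) → Subset m → Fin m → Set
  Deferred t out i = (i ∈ inz ⊎ i ∈ out) × InF t i

  Deferred? : ∀ t out → Decidable (Deferred t out)
  Deferred? t out i = ((i ∈? inz) ⊎-dec (i ∈? out)) ×-dec InF? t i

  outOf : Tree (Vertex m) → Assignment → Subset m
  outOf t σ = fromDec (SatOutside? t σ)

  inOf : Tree (Vertex m) → Subset m → Subset m
  inOf t out = fromDec (Deferred? t out)

  ∈-outOf : ∀ t σ → Characterises (outOf t σ) (SatOutside t σ)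
  ∈-outOf t σ = ∈-fromDec (SatOutside? t σ)

  ∈-inOf : ∀ t out → Characterises (inOf t out) (Deferred t out)
  ∈-inOf t out = ∈-fromDec (Deferred? t out)

  inOf-unique : ∀ t {inn out out′} → Characterises inn (Deferred t out) → out ≡ out′ → inn ≡ inOf t out′
  inOf-unique t {out = out} inn⇔ refl = fromDec-unique (Deferred? t out) inn⇔

  induced : Shape m × Shape m
  induced = (outOf tx τx , inOf tx (outOf ty τy)) , (outOf ty τy , inOf ty (outOf tx τx))

  Fits : Shape m × Shape m → Set
  Fits (sx , sy) = InGen tx ty s (sx , sy) × OfShape F tx sx τx × OfShape F ty sy τy

  Fits? : Decidable Fits
  Fits? (sx , sy) = InGen? tx ty s (sx , sy) ×-dec (OfShape? F tx sx τx ×-dec OfShape? F ty sy τy)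

  ofShape⇒fits-induced : OfShape F tz s τ → Fits induced
  ofShape⇒fits-induced (outz⇔ , inz-cover) =
    ((shape tx τx _ , shape ty τy _) , gen-out , ∈-inOf tx _ , ∈-inOf ty _)
    , (∈-outOf tx τx , cover-x) , (∈-outOf ty τy , cover-y)
    where
    shape : ∀ t σ out → IsShape t (outOf t σ , inOf t out)
    shape t σ out = (λ i → proj₁ ∘ proj₁ (∈-outOf t σ i)) , (λ i → proj₂ ∘ proj₁ (∈-inOf t out i))
    gen-out : Characterises outz (λ i → (i ∈ outOf tx τx ⊎ i ∈ outOf ty τy) × ¬ InF tz i)
    gen-out i = to , from
      where
      to : i ∈ outz → (i ∈ outOf tx τx ⊎ i ∈ outOf ty τy) × ¬ InF tz i
      to i∈ with proj₁ (outz⇔ i) i∈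
      ... | ∉z , sat with Sat-++⁻ τx τy sat
      ... | inj₁ sat-x = inj₁ (proj₂ (∈-outOf tx τx i) (∉z ∘ InF-nodeˡ , sat-x)) , ∉z
      ... | inj₂ sat-y = inj₂ (proj₂ (∈-outOf ty τy i) (∉z ∘ InF-nodeʳ , sat-y)) , ∉z
      from : (i ∈ outOf tx τx ⊎ i ∈ outOf ty τy) × ¬ InF tz i → i ∈ outz
      from (inj₁ i∈x , ∉z) = proj₂ (outz⇔ i) (∉z , Sat-++⁺ˡ τy (proj₂ (proj₁ (∈-outOf tx τx i) i∈x)))
      from (inj₂ i∈y , ∉z) = proj₂ (outz⇔ i) (∉z , Sat-++⁺ʳ τx (proj₂ (proj₁ (∈-outOf ty τy i) i∈y)))
    -- A clause of F_x satisfied only by τ_y is not in F_y, hence it is in out_y.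
    cover-x : ∀ i → InF tx i → Sat τx (F i) ⊎ i ∈ inOf tx (outOf ty τy)
    cover-x i i∈Fx with inz-cover i (InF-nodeˡ i∈Fx)
    ... | inj₂ i∈inz = inj₂ (proj₂ (∈-inOf tx _ i) (inj₁ i∈inz , i∈Fx))
    ... | inj₁ sat with Sat-++⁻ τx τy sat
    ... | inj₁ sat-x = inj₁ sat-x
    ... | inj₂ sat-y = inj₂ (proj₂ (∈-inOf tx _ i) (inj₂ (proj₂ (∈-outOf ty τy i) (Fx#Fy ∘ (i∈Fx ,_) , sat-y)) , i∈Fx))
    cover-y : ∀ i → InF ty i → Sat τy (F i) ⊎ i ∈ inOf ty (outOf tx τx)
    cover-y i i∈Fy with inz-cover i (InF-nodeʳ i∈Fy)
    ... | inj₂ i∈inz = inj₂ (proj₂ (∈-inOf ty _ i) (inj₁ i∈inz , i∈Fy))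
    ... | inj₁ sat with Sat-++⁻ τx τy sat
    ... | inj₂ sat-y = inj₁ sat-y
    ... | inj₁ sat-x = inj₂ (proj₂ (∈-inOf ty _ i) (inj₂ (proj₂ (∈-outOf tx τx i) (Fx#Fy ∘ (_, i∈Fy) , sat-x)) , i∈Fy))

  fits⇒≡induced : ∀ {q} → Fits q → q ≡ induced
  fits⇒≡induced {(outx , inx) , (outy , iny)} ((_ , _ , inx⇔ , iny⇔) , (outx⇔ , _) , (outy⇔ , _)) =
    cong₂ _,_ (cong₂ _,_ outx≡ (inOf-unique tx inx⇔ outy≡)) (cong₂ _,_ outy≡ (inOf-unique ty iny⇔ outx≡))
    where
    outx≡ : outx ≡ outOf tx τx
    outx≡ = fromDec-unique (SatOutside? tx τx) outx⇔
    outy≡ : outy ≡ outOf ty τy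
    outy≡ = fromDec-unique (SatOutside? ty τy) outy⇔

  fits⇒ofShape : ∀ {q} → Fits q → OfShape F tz s τ
  fits⇒ofShape {(outx , inx) , (outy , iny)} ((_ , outz⇔ , inx⇔ , iny⇔) , (outx⇔ , cover-x) , (outy⇔ , cover-y)) =
    (λ i → to i , from i) , cover
    where
    to : ∀ i → i ∈ outz → ¬ InF tz i × Sat τ (F i)
    to i i∈ with proj₁ (outz⇔ i) i∈
    ... | inj₁ i∈x , ∉z = ∉z , Sat-++⁺ˡ τy (proj₂ (proj₁ (outx⇔ i) i∈x))
    ... | inj₂ i∈y , ∉z = ∉z , Sat-++⁺ʳ τx (proj₂ (proj₁ (outy⇔ i) i∈y))
    from : ∀ i → ¬ InF tz i × Sat τ (F i) → i ∈ outz
    from i (∉z , sat) with Sat-++⁻ τx τy sat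
    ... | inj₁ sat-x = proj₂ (outz⇔ i) (inj₁ (proj₂ (outx⇔ i) (∉z ∘ InF-nodeˡ , sat-x)) , ∉z)
    ... | inj₂ sat-y = proj₂ (outz⇔ i) (inj₂ (proj₂ (outy⇔ i) (∉z ∘ InF-nodeʳ , sat-y)) , ∉z)
    cover : ∀ i → InF tz i → Sat τ (F i) ⊎ i ∈ inz
    cover i i∈Fz with InF-node⁻ i∈Fz
    cover i _ | inj₁ i∈Fx with cover-x i i∈Fx
    ... | inj₁ sat-x = inj₁ (Sat-++⁺ˡ τy sat-x)
    ... | inj₂ i∈inx with proj₁ (proj₁ (inx⇔ i) i∈inx)
    ... | inj₁ i∈inz = inj₂ i∈inz
    ... | inj₂ i∈outy = inj₁ (Sat-++⁺ʳ τx (proj₂ (proj₁ (outy⇔ i) i∈outy)))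
    cover i _ | inj₂ i∈Fy with cover-y i i∈Fy
    ... | inj₁ sat-y = inj₁ (Sat-++⁺ʳ τx sat-y)
    ... | inj₂ i∈iny with proj₁ (proj₁ (iny⇔ i) i∈iny)
    ... | inj₁ i∈inz = inj₂ i∈inz
    ... | inj₂ i∈outx = inj₁ (Sat-++⁺ˡ τy (proj₂ (proj₁ (outx⇔ i) i∈outx)))

  ∑-𝟙-Fits : ∑ (cartesianProduct (allShapes m) (allShapes m)) (𝟙 ∘ Fits?) ≡ 𝟙 (OfShape? F tz s τ)
  ∑-𝟙-Fits = ∑-𝟙-unique {P = Fits} {Q = OfShape F tz s τ} Fits? (OfShape? F tz s τ)
    {L = cartesianProduct (allShapes m) (allShapes m)} (OccursOnce-shapePairs induced)
    ofShape⇒fits-induced fits⇒≡induced fits⇒ofShape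

lemma5 : ∀ {m} (F : Fin m → Clause) → IsCNF F →
    (T : Tree (Vertex m)) → IsDecompTree F T →
    (tx ty : Tree (Vertex m)) → node tx ty ≼ T →
    (s : Shape m) → IsShape (node tx ty) s →
    count F (node tx ty) s ≡ genSum F tx ty s
lemma5 {m} F _ T (T! , _) tx ty z≼T s@(outz , inz) _ = begin
  count F (node tx ty) s
    ≡⟨ count-node F tx ty s ⟩
  ∑ Ax (λ a → ∑ Ay (λ b → 𝟙 (OfShape? F (node tx ty) s (a ++ b))))
    ≡⟨ ∑-cong Ax (λ a → ∑-cong Ay (λ b → sym (∑-𝟙-Fits a b))) ⟩
  ∑ Ax (λ a → ∑ Ay (λ b → ∑ pairs (𝟙 ∘ Fits? a b)))
    ≡⟨ trans (∑-cong Ax (λ a → ∑-comm Ay pairs _)) (∑-comm Ax pairs _) ⟩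
  ∑ pairs (λ q → ∑ Ax (λ a → ∑ Ay (λ b → 𝟙 (Fits? a b q))))
    ≡⟨ ∑-cong pairs (λ (sx , sy) → ∑-∑-𝟙-× (InGen? tx ty s (sx , sy)) (OfShape? F tx sx) (OfShape? F ty sy) Ax Ay) ⟩
  ∑ pairs (λ q → 𝟙 (InGen? tx ty s q) * (count F tx (proj₁ q) * count F ty (proj₂ q)))
    ≡⟨ sym (∑-filter (InGen? tx ty s) pairs _) ⟩
  genSum F tx ty s ∎
  where
  Ax Ay : List Assignment
  Ax = assignments (varsOf tx)
  Ay = assignments (varsOf ty)
  pairs : List (Shape m × Shape m)
  pairs = cartesianProduct (allShapes m) (allShapes m)
  Fx#Fy : Disjoint (labels tx) (labels ty)
  Fx#Fy = proj₂ (proj₂ (Unique-++⁻ (labels tx) (Unique-labels-≼ z≼T T!)))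
  open Split F tx ty Fx#Fy outz inz using (Fits?; ∑-𝟙-Fits)
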